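{- Let $n$ be a positive integer with $\gcd(n,6)=1$ which is not prime. Let $p$ be a prime, $s\ge0$ an integer, and $\beta$ an integer with $1\le\beta<n$ such that $p^s\mid\beta$, $p^{s+1}\nmid\beta$ and $p^{s+1}\mid n$. Then there exists an integer $t$ with $0\le t<p$ such that $y=1+\frac{tn}{p^{s+1}}$ lies in $U(n)$ and $|y\beta|_n<\frac n2$.
   Context: For $x\in\mathbb{Z}$, $|x|_n$ denotes the unique integer in $[1,n]$ congruent to $x$ modulo $n$. $U(n)=\{k\in\mathbb{N}: 1\le k\le n-1,\ \gcd(k,n)=1\}$ is the set of units modulo $n$; an integer is said to lie in $U(n)$ when its residue modulo $n$ does. -}

module Defs where

open import Data.Nat.Base
open import Data.Nat.Properties using (m^n≢0)
open import Data.Nat.GCD using (gcd)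
open import Data.Nat.Primality using (Prime; prime⇒nonZero)
open import Data.Product using (_×_)
open import Relation.Binary.PropositionalEquality using (_≡_)

absMod : (n : ℕ) → .{{NonZero n}} → ℕ → ℕ
absMod n x with x % n
... | zero  = n
... | suc r = suc r

InUSet : ℕ → ℕ → Set
InUSet n k = (1 ≤ k) × (k ≤ n ∸ 1) × (gcd k n ≡ 1)

InU : (n : ℕ) → .{{NonZero n}} → ℕ → Set
InU n y = InUSet n (y % n)

divPow : (n p s : ℕ) → Prime p → ℕ
divPow n p s pp = _/_ n (p ^ suc s) {{m^n≢0 p (suc s) {{prime⇒nonZero pp}}}}

{-# OPTIONS --safe #-}
-- Put m = n / p^(s+1) and d = m p^s, so n = p d, and write β = b p^s with p ∤ b and
-- β = q d + r with r < d, q < p.  For y = 1 + t m we get y β = (q + t b) d + r, hence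
-- y β mod n = ((q + t b) mod p) d + r.  Since p ∤ b, the residue of q + t b can be any
-- j < p; taking j ∈ {1, 2} if r = 0 and j ∈ {0, 1} otherwise puts y β mod n in [1, 2d],
-- which is below n / 2 because gcd(n, 6) = 1 forces p ≥ 5.  Finally y is coprime to
-- m p^(s+1) = n unless p ∣ y, and that happens for at most one t < p, so one of the two
-- choices of j yields a unit.
module Submission where

open import Data.Empty using (⊥-elim)
open import Data.Nat.Base
open import Data.Nat.Coprimality as Coprimality
  using (Coprime; coprime-Bézout; coprime-divisor; coprime⇒gcd≡1; gcd≡1⇒coprime)
open import Data.Nat.Divisibility
open import Data.Nat.DivMod
open import Data.Nat.GCD using (gcd; module Bézout)
open import Data.Nat.Primality using (Prime; prime⇒nonZero; prime⇒nonTrivial; prime⇒irreducible; euclidsLemma)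
open import Data.Nat.Properties
open import Data.Nat.Solver using (module +-*-Solver)
open import Data.Product using (Σ; ∃; _×_; _,_)
open import Data.Sum using (inj₁; inj₂; [_,_]′)
open import Relation.Binary.PropositionalEquality
open import Relation.Nullary using (¬_; yes; no)

open import Defs

open +-*-Solver
open ≡-Reasoning

%-+ˡ-cong : ∀ {d x y} m .{{_ : NonZero d}} → x % d ≡ y % d → (m + x) % d ≡ (m + y) % d
%-+ˡ-cong {d} {x} {y} m eq = begin
  (m + x) % d         ≡⟨ %-distribˡ-+ m x d ⟩
  (m % d + x % d) % d ≡⟨ cong (λ u → (m % d + u) % d) eq ⟩
  (m % d + y % d) % d ≡⟨ %-distribˡ-+ m y d ⟨
  (m + y) % d         ∎

%-*ˡ-cong : ∀ {d x y} m .{{_ : NonZero d}} → x % d ≡ y % d → (m * x) % d ≡ (m * y) % d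
%-*ˡ-cong {d} {x} {y} m eq = begin
  (m * x) % d           ≡⟨ %-distribˡ-* m x d ⟩
  (m % d * (x % d)) % d ≡⟨ cong (λ u → (m % d * u) % d) eq ⟩
  (m % d * (y % d)) % d ≡⟨ %-distribˡ-* m y d ⟨
  (m * y) % d           ∎

%-*ʳ-cong : ∀ {d x y} m .{{_ : NonZero d}} → x % d ≡ y % d → (x * m) % d ≡ (y * m) % d
%-*ʳ-cong {d} {x} {y} m eq = begin
  (x * m) % d ≡⟨ cong (_% d) (*-comm x m) ⟩
  (m * x) % d ≡⟨ %-*ˡ-cong m eq ⟩
  (m * y) % d ≡⟨ cong (_% d) (*-comm m y) ⟩
  (y * m) % d ∎

[c*d+r]%n≡[c%p]*d+r : ∀ {n p d r} c .{{_ : NonZero p}} .{{_ : NonZero n}} →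
                      n ≡ p * d → r < d → (c * d + r) % n ≡ c % p * d + r
[c*d+r]%n≡[c%p]*d+r {p = p} {d} {r} c refl r<d = begin
  (c * d + r) % (p * d)   ≡⟨ [m*n+o]%[p*n]≡[m*n]%[p*n]+o c p r<d ⟩
  (c * d) % (p * d) + r   ≡⟨ cong (_+ r) (m%n*o≡m*o%[n*o] c p d) ⟨
  c % p * d + r           ∎

absMod≡% : ∀ {n x} .{{_ : NonZero n}} → 1 ≤ x % n → absMod n x ≡ x % n
absMod≡% {n} {x} 1≤x%n with x % n
... | suc _ = refl

prime∤1 : ∀ {p} → Prime p → ¬ p ∣ 1
prime∤1 pp p∣1 = nonTrivial⇒≢1 {{prime⇒nonTrivial pp}} (∣1⇒≡1 p∣1)

prime⇒1%p≡1 : ∀ {p} .{{_ : NonZero p}} → Prime p → 1 % p ≡ 1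
prime⇒1%p≡1 {p} pp = m<n⇒m%n≡m (nonTrivial⇒n>1 p {{prime⇒nonTrivial pp}})

prime∤⇒coprime : ∀ {p a} → Prime p → ¬ p ∣ a → Coprime p a
prime∤⇒coprime pp p∤a (i∣p , i∣a) with prime⇒irreducible pp i∣p
... | inj₁ i≡1 = i≡1
... | inj₂ refl = ⊥-elim (p∤a i∣a)

coprime-*ʳ : ∀ {a x y} → Coprime a x → Coprime a y → Coprime a (x * y)
coprime-*ʳ {x = x} a⊥x a⊥y {i} (i∣a , i∣xy) = a⊥y (i∣a , coprime-divisor i⊥x i∣xy)
  where
  i⊥x : Coprime i x
  i⊥x (k∣i , k∣x) = a⊥x (∣-trans k∣i i∣a , k∣x)

coprime-^ʳ : ∀ {a x} → Coprime a x → ∀ k → Coprime a (x ^ k)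
coprime-^ʳ a⊥x zero    (_ , i∣1) = ∣1⇒≡1 i∣1
coprime-^ʳ a⊥x (suc k) = coprime-*ʳ a⊥x (coprime-^ʳ a⊥x k)

coprime-1+t*m : ∀ t m → Coprime (1 + t * m) m
coprime-1+t*m t m {i} (i∣1+tm , i∣m) = ∣1⇒≡1 (∣m+n∣m⇒∣n i∣tm+1 (∣n⇒∣m*n t i∣m))
  where
  i∣tm+1 : i ∣ t * m + 1
  i∣tm+1 = subst (i ∣_) (+-comm 1 (t * m)) i∣1+tm

prime∤1+t*m⇒coprime[m*p^k] : ∀ {p t m} → Prime p → ¬ p ∣ 1 + t * m → ∀ k → Coprime (1 + t * m) (m * p ^ k)
prime∤1+t*m⇒coprime[m*p^k] {t = t} {m} pp p∤1+tm k =
  coprime-*ʳ (coprime-1+t*m t m) (coprime-^ʳ (Coprimality.sym (prime∤⇒coprime pp p∤1+tm)) k)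

coprime-% : ∀ {y n} .{{_ : NonZero n}} → Coprime y n → Coprime (y % n) n
coprime-% y⊥n (i∣y%n , i∣n) = y⊥n (∣n∣m%n⇒∣m i∣n i∣y%n , i∣n)

coprime⇒InU : ∀ {n y} .{{_ : NonZero n}} → 1 < n → Coprime y n → InU n y
coprime⇒InU {n@(suc _)} {y} 1<n y⊥n =
  n≢0⇒n>0 y%n≢0 , suc[m]≤n⇒m≤pred[n] (m%n<n y n) , coprime⇒gcd≡1 (coprime-% y⊥n)
  where
  y%n≢0 : y % n ≢ 0
  y%n≢0 y%n≡0 = <⇒≢ 1<n (sym (coprime-% y⊥n (subst (n ∣_) (sym y%n≡0) (n ∣0) , ∣-refl)))

gcd[n,6]≡1⇒5≤divisor : ∀ {n d} → gcd n 6 ≡ 1 → 1 < d → d ∣ n → 5 ≤ d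
gcd[n,6]≡1⇒5≤divisor {n} gcd≡1 = go _
  where
  n⊥6 : Coprime n 6
  n⊥6 = gcd≡1⇒coprime gcd≡1
  go : ∀ d → 1 < d → d ∣ n → 5 ≤ d
  go 2 _ 2∣n with n⊥6 {2} (2∣n , divides 3 refl)
  ... | ()
  go 3 _ 3∣n with n⊥6 {3} (3∣n , divides 2 refl)
  ... | ()
  go 4 _ 4∣n with n⊥6 {2} (∣-trans (divides 2 refl) 4∣n , divides 3 refl)
  ... | ()
  go 1 (s≤s ()) _
  go (suc (suc (suc (suc (suc k))))) _ _ = m≤m+n 5 k

%-inverse : ∀ {p b} .{{_ : NonZero p}} → Prime p → ¬ p ∣ b → ∃ λ u → (u * b) % p ≡ 1
%-inverse {p} {b} pp p∤b with coprime-Bézout (prime∤⇒coprime pp p∤b)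
... | Bézout.-+ x y 1+xp≡yb = y , (begin
  (y * b) % p     ≡⟨ cong (_% p) 1+xp≡yb ⟨
  (1 + x * p) % p ≡⟨ [m+kn]%n≡m%n 1 x p ⟩
  1 % p           ≡⟨ prime⇒1%p≡1 pp ⟩
  1               ∎)
%-inverse {p@(suc p-1)} {b} pp p∤b | Bézout.+- x y 1+yb≡xp = y * p-1 , (begin
  (y * p-1 * b) % p         ≡⟨ [m+n]%n≡m%n (y * p-1 * b) p ⟨
  (y * p-1 * b + p) % p     ≡⟨ cong (_% p) y[p-1]b+p≡1+x[p-1]p ⟩
  (1 + x * p-1 * p) % p     ≡⟨ [m+kn]%n≡m%n 1 (x * p-1) p ⟩
  1 % p                     ≡⟨ prime⇒1%p≡1 pp ⟩
  1                         ∎)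
  where
  -- y (p - 1) ≡ - y is an inverse of b modulo p
  y[p-1]b+p≡1+x[p-1]p : y * p-1 * b + p ≡ 1 + x * p-1 * p
  y[p-1]b+p≡1+x[p-1]p = begin
    y * p-1 * b + p       ≡⟨ solve 3 (λ y p-1 b → y :* p-1 :* b :+ (con 1 :+ p-1)
                                             := con 1 :+ (con 1 :+ y :* b) :* p-1) refl y p-1 b ⟩
    1 + (1 + y * b) * p-1 ≡⟨ cong (λ u → 1 + u * p-1) 1+yb≡xp ⟩
    1 + x * p * p-1       ≡⟨ cong (1 +_) (solve 3 (λ x p p-1 → x :* p :* p-1 := x :* p-1 :* p) refl x p p-1) ⟩
    1 + x * p-1 * p       ∎

linear-congruence : ∀ {p b q} .{{_ : NonZero p}} → Prime p → ¬ p ∣ b → q ≤ p → ∀ j →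
                    ∃ λ t → t < p × (q + t * b) % p ≡ j % p
linear-congruence {p} {b} {q} pp p∤b q≤p j with %-inverse pp p∤b
... | u , ub≡1 = c % p , m%n<n c p , (begin
  (q + c % p * b) % p           ≡⟨ %-+ˡ-cong q (%-*ʳ-cong b (m%n%n≡m%n c p)) ⟩
  (q + c * b) % p               ≡⟨ cong (λ v → (q + v) % p) (*-assoc (j + (p ∸ q)) u b) ⟩
  (q + (j + (p ∸ q)) * (u * b)) % p
    ≡⟨ %-+ˡ-cong q (%-*ˡ-cong (j + (p ∸ q)) (trans ub≡1 (sym (prime⇒1%p≡1 pp)))) ⟩
  (q + (j + (p ∸ q)) * 1) % p   ≡⟨ cong (_% p) (solve 3 (λ q j w → q :+ (j :+ w) :* con 1 := j :+ (q :+ w)) refl q j (p ∸ q)) ⟩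
  (j + (q + (p ∸ q))) % p       ≡⟨ cong (λ v → (j + v) % p) (m+[n∸m]≡n q≤p) ⟩
  (j + p) % p                   ≡⟨ [m+n]%n≡m%n j p ⟩
  j % p                         ∎)
  where
  c : ℕ
  c = (j + (p ∸ q)) * u

prime∣1+t*m-unique : ∀ {p m t₁ t₂} → Prime p → t₁ < p → t₂ < p →
                     p ∣ 1 + t₁ * m → p ∣ 1 + t₂ * m → t₁ ≡ t₂
prime∣1+t*m-unique {p} {m} {t₁} {t₂} pp t₁<p t₂<p p∣y₁ p∣y₂ =
  [ (λ t₁≤t₂ → ordered t₁≤t₂ t₂<p p∣y₁ p∣y₂) , (λ t₂≤t₁ → sym (ordered t₂≤t₁ t₁<p p∣y₂ p∣y₁)) ]′ (≤-total t₁ t₂)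
  where
  instance _ = prime⇒nonZero pp
  ordered : ∀ {a c} → a ≤ c → c < p → p ∣ 1 + a * m → p ∣ 1 + c * m → a ≡ c
  ordered {a} {c} a≤c c<p p∣1+am p∣1+cm = ≤-antisym a≤c (m∸n≡0⇒m≤n c∸a≡0)
    where
    k : ℕ
    k = c ∸ a
    1+cm≡1+am+km : 1 + c * m ≡ (1 + a * m) + k * m
    1+cm≡1+am+km = begin
      1 + c * m         ≡⟨ cong (λ u → 1 + u * m) (m+[n∸m]≡n a≤c) ⟨
      1 + (a + k) * m   ≡⟨ solve 3 (λ a k m → con 1 :+ (a :+ k) :* m := (con 1 :+ a :* m) :+ k :* m) refl a k m ⟩
      1 + a * m + k * m ∎
    c∸a≡0 : k ≡ 0
    c∸a≡0 with euclidsLemma k m pp (∣m+n∣m⇒∣n (subst (p ∣_) 1+cm≡1+am+km p∣1+cm) p∣1+am)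
    ... | inj₁ p∣k = trans (sym (m<n⇒m%n≡m (≤-<-trans (m∸n≤m c a) c<p))) (n∣m⇒m%n≡0 k p p∣k)
    ... | inj₂ p∣m = ⊥-elim (prime∤1 pp (∣m+n∣m⇒∣n (subst (p ∣_) (+-comm 1 (a * m)) p∣1+am) (∣n⇒∣m*n a p∣m)))

linear-congruence-avoiding-root :
  ∀ {p b q m j₁ j₂} .{{_ : NonZero p}} (G : ℕ → Set) → Prime p → ¬ p ∣ b → q ≤ p →
  j₁ ≢ j₂ → j₁ < p → j₂ < p → G j₁ → G j₂ →
  ∃ λ t → t < p × ¬ p ∣ 1 + t * m × G ((q + t * b) % p)
linear-congruence-avoiding-root {p} {b} {q} {m} {j₁} {j₂} G pp p∤b q≤p j₁≢j₂ j₁<p j₂<p g₁ g₂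
  with linear-congruence pp p∤b q≤p j₁ | linear-congruence pp p∤b q≤p j₂
... | t₁ , t₁<p , hit₁ | t₂ , t₂<p , hit₂ with p ∣? 1 + t₁ * m
...   | no p∤y₁  = t₁ , t₁<p , p∤y₁ , subst G (sym (trans hit₁ (m<n⇒m%n≡m j₁<p))) g₁
...   | yes p∣y₁ = t₂ , t₂<p , p∤y₂ , subst G (sym (trans hit₂ (m<n⇒m%n≡m j₂<p))) g₂
  where
  p∤y₂ : ¬ p ∣ 1 + t₂ * m
  p∤y₂ p∣y₂ = j₁≢j₂ (begin
    j₁                  ≡⟨ m<n⇒m%n≡m j₁<p ⟨
    j₁ % p              ≡⟨ hit₁ ⟨
    (q + t₁ * b) % p    ≡⟨ cong (λ t → (q + t * b) % p) (prime∣1+t*m-unique pp t₁<p t₂<p p∣y₁ p∣y₂) ⟩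
    (q + t₂ * b) % p    ≡⟨ hit₂ ⟩
    j₂ % p              ≡⟨ m<n⇒m%n≡m j₂<p ⟩
    j₂                  ∎)

[1,_]∋_ : ℕ → ℕ → Set
[1, u ]∋ x = 1 ≤ x × x ≤ u

infix 4 [1,_]∋_

two-offsets-in-[1,2d] : ∀ {d r} → r < d →
  Σ ℕ λ j₁ → Σ ℕ λ j₂ → j₁ ≢ j₂ × j₁ ≤ 2 × j₂ ≤ 2 ×
  [1, 2 * d ]∋ j₁ * d + r × [1, 2 * d ]∋ j₂ * d + r
two-offsets-in-[1,2d] {d@(suc _)} {zero} _ =
  1 , 2 , (λ ()) , s≤s z≤n , ≤-refl ,
  (s≤s z≤n , ≤-trans (≤-reflexive (+-identityʳ (1 * d))) (m≤n+m (1 * d) d)) ,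
  (s≤s z≤n , ≤-reflexive (+-identityʳ (2 * d)))
two-offsets-in-[1,2d] {d} {suc r} r<d =
  0 , 1 , (λ ()) , z≤n , s≤s z≤n ,
  (s≤s z≤n , ≤-trans (<⇒≤ r<d) (m≤m+n d (1 * d))) ,
  (≤-trans (s≤s z≤n) (m≤n+m (suc r) (1 * d)) ,
   ≤-trans (+-monoʳ-≤ (1 * d) (<⇒≤ r<d)) (≤-reflexive (+-comm (1 * d) d)))

2*[≤2*d]<p*d : ∀ {p d x} .{{_ : NonZero d}} → 5 ≤ p → x ≤ 2 * d → 2 * x < p * d
2*[≤2*d]<p*d {p} {d} 5≤p x≤2d = ≤-<-trans (*-monoʳ-≤ 2 x≤2d) 4d<pd
  where
  4d<pd : 2 * (2 * d) < p * d
  4d<pd = subst (_< p * d) (*-assoc 2 2 d) (<-≤-trans (*-monoˡ-< d (n<1+n 4)) (*-monoˡ-≤ d 5≤p))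

[1+t*m]*β≡[q+t*b]*[m*P]+r : ∀ {β b P q r} t m → β ≡ b * P → β ≡ q * (m * P) + r →
                            (1 + t * m) * β ≡ (q + t * b) * (m * P) + r
[1+t*m]*β≡[q+t*b]*[m*P]+r {β} {b} {P} {q} {r} t m β≡bP β≡q[mP]+r = begin
  (1 + t * m) * β                   ≡⟨ solve 3 (λ t m β → (con 1 :+ t :* m) :* β := β :+ t :* m :* β) refl t m β ⟩
  β + t * m * β                     ≡⟨ cong₂ (λ u v → u + t * m * v) β≡q[mP]+r β≡bP ⟩
  q * (m * P) + r + t * m * (b * P) ≡⟨ solve 6 (λ q m P r t b → q :* (m :* P) :+ r :+ t :* m :* (b :* P)
                                                             := (q :+ t :* b) :* (m :* P) :+ r) refl q m P r t b ⟩
  (q + t * b) * (m * P) + r         ∎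

corollary2p3 : (n : ℕ) → .{{_ : NonZero n}} → gcd n 6 ≡ 1 → ¬ Prime n →
    (p s β : ℕ) → (pp : Prime p) → 1 ≤ β → β < n →
    p ^ s ∣ β → p ^ suc s ∤ β → p ^ suc s ∣ n →
    Σ ℕ (λ t → t < p ×
      InU n (1 + t * divPow n p s pp) ×
      2 * absMod n ((1 + t * divPow n p s pp) * β) < n)
corollary2p3 n gcd[n,6]≡1 _ p s β pp _ β<n (divides b β≡b*pˢ) pˢ⁺¹∤β pˢ⁺¹∣n =
  let j₁ , j₂ , j₁≢j₂ , j₁≤2 , j₂≤2 , j₁-good , j₂-good = two-offsets-in-[1,2d] r<d
      t , t<p , p∤1+tm , t-good = linear-congruence-avoiding-root {m = m} Good pp p∤b (<⇒≤ q<p)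
                                    j₁≢j₂ (≤2⇒<p j₁≤2) (≤2⇒<p j₂≤2) j₁-good j₂-good
  in t , t<p , 1+tm∈U t p∤1+tm , 2*|[1+tm]β|<n t t-good
  where
  instance
    p≢0 : NonZero p
    p≢0 = prime⇒nonZero pp
    pˢ⁺¹≢0 : NonZero (p ^ suc s)
    pˢ⁺¹≢0 = m^n≢0 p (suc s)
  m d : ℕ
  m = divPow n p s pp
  d = m * p ^ s
  m*pˢ⁺¹≡n : m * p ^ suc s ≡ n
  m*pˢ⁺¹≡n = m/n*n≡m pˢ⁺¹∣n
  n≡p*d : n ≡ p * d
  n≡p*d = trans (sym m*pˢ⁺¹≡n) (solve 3 (λ m p P → m :* (p :* P) := p :* (m :* P)) refl m p (p ^ s))
  instance
    d≢0 : NonZero d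
    d≢0 = ≢-nonZero λ d≡0 → ≢-nonZero⁻¹ n (trans n≡p*d (trans (cong (p *_) d≡0) (*-zeroʳ p)))
  q r : ℕ
  q = β / d
  r = β % d
  r<d : r < d
  r<d = m%n<n β d
  q<p : q < p
  q<p = m<n*o⇒m/o<n (subst (β <_) n≡p*d β<n)
  β≡q*d+r : β ≡ q * d + r
  β≡q*d+r = trans (m≡m%n+[m/n]*n β d) (+-comm r (q * d))
  p∤b : ¬ p ∣ b
  p∤b p∣b = pˢ⁺¹∤β (subst (p ^ suc s ∣_) (sym β≡b*pˢ) (*-monoˡ-∣ (p ^ s) p∣b))
  1<p : 1 < p
  1<p = nonTrivial⇒n>1 p {{prime⇒nonTrivial pp}}
  p∣n : p ∣ n
  p∣n = ∣-trans (m∣m*n (p ^ s)) pˢ⁺¹∣n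
  5≤p : 5 ≤ p
  5≤p = gcd[n,6]≡1⇒5≤divisor gcd[n,6]≡1 1<p p∣n
  ≤2⇒<p : ∀ {j} → j ≤ 2 → j < p
  ≤2⇒<p j≤2 = ≤-trans (s≤s j≤2) (≤-trans (m≤m+n 3 2) 5≤p)
  Good : ℕ → Set
  Good j = [1, 2 * d ]∋ j * d + r
  residue : ∀ t → ((1 + t * m) * β) % n ≡ (q + t * b) % p * d + r
  residue t = trans (cong (_% n) ([1+t*m]*β≡[q+t*b]*[m*P]+r {q = q} t m β≡b*pˢ β≡q*d+r))
                    ([c*d+r]%n≡[c%p]*d+r {p = p} (q + t * b) n≡p*d r<d)
  1+tm∈U : ∀ t → ¬ p ∣ 1 + t * m → InU n (1 + t * m)
  1+tm∈U t p∤1+tm = coprime⇒InU (<-≤-trans 1<p (∣⇒≤ p∣n))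
    (subst (Coprime (1 + t * m)) m*pˢ⁺¹≡n (prime∤1+t*m⇒coprime[m*p^k] {t = t} {m} pp p∤1+tm (suc s)))
  2*|[1+tm]β|<n : ∀ t → Good ((q + t * b) % p) → 2 * absMod n ((1 + t * m) * β) < n
  2*|[1+tm]β|<n t (1≤x , x≤2d) = subst₂ (λ a c → 2 * a < c) (sym |[1+tm]β|≡x) (sym n≡p*d) (2*[≤2*d]<p*d 5≤p x≤2d)
    where
    |[1+tm]β|≡x : absMod n ((1 + t * m) * β) ≡ (q + t * b) % p * d + r
    |[1+tm]β|≡x = trans (absMod≡% (subst (1 ≤_) (sym (residue t)) 1≤x)) (residue t)
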